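{- Let $H = \{ e_i \leq f_i \mid i\in I\}$ be a set of hypotheses and let $e,f$ be expressions (all in a fragment $\mathcal F$). If $e$ and all $f_i$ are fixpoint-free, then we have \begin{align*} N(E,\mathcal F), H \vdash e \leq f \iff H^*[\![e]\!]_E \subseteq H^*[\![f]\!]_E\enspace. \end{align*}
   Context: Fix a signature $\Sigma$, variables $X$, and a set $E$ of linear and regular term equations. Expressions are built from variables, symbols of $\Sigma$, $0$, $+$, and least fixpoints $\mu x.e$. Atoms are terms modulo $E$, languages are sets of atoms, and $[\![e]\!]_E$ is the standard language interpretation of $e$ (interpretation in the powerset-lifted model of atoms under $x\mapsto\{x\}$). For a set $H$ of hypotheses, $H^*(L)$ is the least language containing $L$ that is closed under: if $C[\![f]\!]_E\subseteq L$ for a context $C$ (an atom with exactly one hole) and $(e\leq f)\in H$, then $C[\![e]\!]_E\subseteq L$. A fragment $\mathcal F$ is a set of closed expressions containing $0$ and the variables, closed under $+$, operations of $\Sigma$, substitution of variables by elements of $\mathcal F$, sub-expressions, and such that $e[\mu x.e/x]$-style unfoldings $e[f/x]$ lie in $\mathcal F$ whenever $\mu x.e$ and $f$ do. $N(E,\mathcal F)$ is the naive axiomatisation: $+,0$ form a semilattice ($0\leq x$, $x+x\leq x$, $x\leq x+y$, $y\leq x+y$); each symbol of $\Sigma$ is strict and distributes over binary $+$ in each argument; both directions of each equation in $E$; and for each $\mu x.e\in\mathcal F$, $e[\mu x.e/x]\leq\mu x.e$ and $e[f/x]\leq f\rightarrow \mu x.e\leq f$ for $f\in\mathcal F$. $Q,H\vdash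 e\leq f$ is derivability using instances of axioms of $Q$, hypotheses of $H$ as is, reflexivity, transitivity, and monotonicity of $+$ and of the symbols of $\Sigma$. -}

module Defs where

open import Data.Nat using (ℕ; zero; suc)
open import Data.Fin using (Fin; zero; suc) renaming (_≟_ to _≟ᶠ_)
open import Data.Product using (Σ; _×_; _,_)
open import Relation.Nullary using (yes; no)
open import Relation.Binary.Definitions using (DecidableEquality)
open import Relation.Binary.PropositionalEquality using (_≡_)
open import Function.Bundles using (_⇔_)

record Signature : Set₁ where
  field
    Sym   : Set
    arity : Sym → ℕ
open Signature public

module Syntax (Sg : Signature) (X : Set) (_≟_ : DecidableEquality X) where

  -- Terms over Σ and X (atoms are terms modulo E)

  data Term : Set where
    tvar  : X → Term
    tnode : (s : Sym Sg) → (Fin (arity Sg s) → Term) → Term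

  tsub : (X → Term) → Term → Term
  tsub σ (tvar x)     = σ x
  tsub σ (tnode s ts) = tnode s (λ i → tsub σ (ts i))

  data Occurs (x : X) : Term → Set where
    here   : Occurs x (tvar x)
    inside : ∀ {s ts} (i : Fin (arity Sg s)) → Occurs x (ts i) → Occurs x (tnode s ts)

  data LinearTerm : Term → Set where
    lvar  : ∀ x → LinearTerm (tvar x)
    lnode : ∀ {s ts} → (∀ i → LinearTerm (ts i))
          → (∀ x i j → Occurs x (ts i) → Occurs x (ts j) → i ≡ j)
          → LinearTerm (tnode s ts)

  LinearEq : Term → Term → Set
  LinearEq l r = LinearTerm l × LinearTerm r

  RegularEq : Term → Term → Set
  RegularEq l r = ∀ x → Occurs x l ⇔ Occurs x r

  module _ (E : Term → Term → Set) where
    data _≈E_ : Term → Term → Set where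
      ax    : ∀ {l r} → E l r → (σ : X → Term) → tsub σ l ≈E tsub σ r
      refl  : ∀ {t} → t ≈E t
      sym   : ∀ {t u} → t ≈E u → u ≈E t
      trans : ∀ {t u v} → t ≈E u → u ≈E v → t ≈E v
      cong  : ∀ {s ts us} → (∀ i → ts i ≈E us i) → tnode s ts ≈E tnode s us

  -- Expressions.  Free variables are the elements of X; variables bound
  -- by μ are represented by de Bruijn indices (Expr n has n bound
  -- variables in scope).  Closed expressions are Expr 0.

  data Expr (n : ℕ) : Set where
    var  : X → Expr n
    bv   : Fin n → Expr n
    𝟘    : Expr n
    _⊕_  : Expr n → Expr n → Expr n
    op   : (s : Sym Sg) → (Fin (arity Sg s) → Expr n) → Expr n
    μ    : Expr (suc n) → Expr n

  Exp : Set
  Exp = Expr 0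

  ext : ∀ {m k} → (Fin m → Fin k) → Fin (suc m) → Fin (suc k)
  ext ρ zero    = zero
  ext ρ (suc i) = suc (ρ i)

  rename : ∀ {m k} → (Fin m → Fin k) → Expr m → Expr k
  rename ρ (var x)  = var x
  rename ρ (bv i)   = bv (ρ i)
  rename ρ 𝟘        = 𝟘
  rename ρ (a ⊕ b)  = rename ρ a ⊕ rename ρ b
  rename ρ (op s es) = op s (λ i → rename ρ (es i))
  rename ρ (μ e)    = μ (rename (ext ρ) e)

  exts : ∀ {m k} → (Fin m → Expr k) → Fin (suc m) → Expr (suc k)
  exts σ zero    = bv zero
  exts σ (suc i) = rename suc (σ i)

  subst : ∀ {m k} → (Fin m → Expr k) → Expr m → Expr k
  subst σ (var x)   = var x
  subst σ (bv i)    = σ i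
  subst σ 𝟘         = 𝟘
  subst σ (a ⊕ b)   = subst σ a ⊕ subst σ b
  subst σ (op s es) = op s (λ i → subst σ (es i))
  subst σ (μ e)     = μ (subst (exts σ) e)

  -- inst e g : the body e of μ.e with its bound variable replaced by g
  -- (this is e[g/x] for μx.e in named syntax)
  inst : ∀ {n} → Expr (suc n) → Expr n → Expr n
  inst e g = subst (λ { zero → g ; (suc i) → bv i }) e

  weaken : ∀ {n} → Exp → Expr n
  weaken = rename (λ ())

  lsub : ∀ {n} → X → Exp → Expr n → Expr n
  lsub x g (var y) with x ≟ y
  ... | yes _ = weaken g
  ... | no  _ = var y
  lsub x g (bv i)    = bv i
  lsub x g 𝟘         = 𝟘
  lsub x g (a ⊕ b)   = lsub x g a ⊕ lsub x g b
  lsub x g (op s es) = op s (λ i → lsub x g (es i))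
  lsub x g (μ e)     = μ (lsub x g e)

  texp : (X → Exp) → Term → Exp
  texp σ (tvar x)     = σ x
  texp σ (tnode s ts) = op s (λ i → texp σ (ts i))

  data FixFree : Exp → Set where
    ff-var : ∀ x → FixFree (var x)
    ff-0   : FixFree 𝟘
    ff-+   : ∀ {a b} → FixFree a → FixFree b → FixFree (a ⊕ b)
    ff-op  : ∀ {s es} → (∀ i → FixFree (es i)) → FixFree (op s es)

  record IsFragment (F : Exp → Set) : Set where
    field
      has-0     : F 𝟘
      has-var   : ∀ x → F (var x)
      clo-+     : ∀ {a b} → F a → F b → F (a ⊕ b)
      clo-op    : ∀ {s es} → (∀ i → F (es i)) → F (op s es)
      clo-subst : ∀ {e g} x → F e → F g → F (lsub x g e)
      sub-+ˡ    : ∀ {a b} → F (a ⊕ b) → F a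
      sub-+ʳ    : ∀ {a b} → F (a ⊕ b) → F b
      sub-op    : ∀ {s es} → F (op s es) → ∀ i → F (es i)
      -- the body of μx.e, with x read as a free variable (any name)
      sub-μ     : ∀ {e} → F (μ e) → ∀ x → F (inst e (var x))
      clo-unfold : ∀ {e g} → F (μ e) → F g → F (inst e g)

  module Semantics (E : Term → Term → Set) where

    Lang : Set₁
    Lang = Term → Set

    _⊆_ : Lang → Lang → Set
    L ⊆ K = ∀ t → L t → K t

    -- terms generated by a closed expression (interpretation in the
    -- powerset-lifted term model, x ↦ {x}; μ is the least fixpoint,
    -- given inductively by unfolding)
    data Gen : Exp → Term → Set where
      g-var  : ∀ x → Gen (var x) (tvar x)
      g-+ˡ   : ∀ {a b t} → Gen a t → Gen (a ⊕ b) t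
      g-+ʳ   : ∀ {a b t} → Gen b t → Gen (a ⊕ b) t
      g-op   : ∀ {s es ts} → (∀ i → Gen (es i) (ts i)) → Gen (op s es) (tnode s ts)
      g-μ    : ∀ {e t} → Gen (inst e (μ e)) t → Gen (μ e) t

    -- ⟦ e ⟧_E as a set of terms closed under E-equivalence (i.e. a set of atoms)
    ⟦_⟧ : Exp → Lang
    ⟦ e ⟧ t = Σ Term λ u → _≈E_ E t u × Gen e u

    data Ctx : Set where
      □    : Ctx
      node : (s : Sym Sg) (i : Fin (arity Sg s)) → (Fin (arity Sg s) → Term) → Ctx → Ctx

    plug : Ctx → Term → Term
    plug □ t = t
    plug (node s i ts C) t = tnode s (λ j → sel j)
      where
        sel : Fin (arity Sg s) → Term
        sel j with j ≟ᶠ i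
        ... | yes _ = plug C t
        ... | no  _ = ts j

    module Closure {I : Set} (lhs rhs : I → Exp) where
      data H* (L : Lang) : Lang where
        base : ∀ {t} → L t → H* L t
        step : ∀ {t u} (h : I) (C : Ctx)
             → (∀ v → ⟦ rhs h ⟧ v → H* L (plug C v))
             → ⟦ lhs h ⟧ u → _≈E_ E t (plug C u)
             → H* L t

  module Naive (E : Term → Term → Set) (F : Exp → Set)
               {I : Set} (lhs rhs : I → Exp) where

    upd : ∀ {s} → (Fin (arity Sg s) → Exp) → Fin (arity Sg s) → Exp → Fin (arity Sg s) → Exp
    upd es i a j with j ≟ᶠ i
    ... | yes _ = a
    ... | no  _ = es j

    data _⊢_≤_ : Exp → Exp → Set where
      0≤     : ∀ {a} → _⊢_≤_ 𝟘 a
      idem   : ∀ {a} → _⊢_≤_ (a ⊕ a) a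
      inl    : ∀ {a b} → _⊢_≤_ a (a ⊕ b)
      inr    : ∀ {a b} → _⊢_≤_ b (a ⊕ b)
      strict   : ∀ {s es} i → _⊢_≤_ (op s (upd es i 𝟘)) 𝟘
      strict⁻  : ∀ {s es} i → _⊢_≤_ 𝟘 (op s (upd es i 𝟘))
      distr    : ∀ {s es} i a b
               → _⊢_≤_ (op s (upd es i (a ⊕ b))) (op s (upd es i a) ⊕ op s (upd es i b))
      distr⁻   : ∀ {s es} i a b
               → _⊢_≤_ (op s (upd es i a) ⊕ op s (upd es i b)) (op s (upd es i (a ⊕ b)))
      eqn    : ∀ {l r} → E l r → (σ : X → Exp) → _⊢_≤_ (texp σ l) (texp σ r)
      eqn⁻   : ∀ {l r} → E l r → (σ : X → Exp) → _⊢_≤_ (texp σ r) (texp σ l)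
      unfold : ∀ {e} → F (μ e) → _⊢_≤_ (inst e (μ e)) (μ e)
      induct : ∀ {e f} → F (μ e) → F f → _⊢_≤_ (inst e f) f → _⊢_≤_ (μ e) f
      hyp    : ∀ h → _⊢_≤_ (lhs h) (rhs h)
      refl   : ∀ {a} → _⊢_≤_ a a
      trans  : ∀ {a b c} → _⊢_≤_ a b → _⊢_≤_ b c → _⊢_≤_ a c
      mono-+ : ∀ {a b c d} → _⊢_≤_ a b → _⊢_≤_ c d → _⊢_≤_ (a ⊕ c) (b ⊕ d)
      mono-op : ∀ {s es fs} → (∀ i → _⊢_≤_ (es i) (fs i)) → _⊢_≤_ (op s es) (op s fs)

module Submission where

-- Soundness is checked rule by rule in the model of H*-closed languages. Two rules are not
-- local. Monotonicity of an operation needs H* to commute with forming nodes, which is shown by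
-- replacing the arguments one at a time, each inside a context. For the induction rule, a
-- derivation that t is generated by μx.e is traversed and every recursive occurrence of μx.e is
-- replaced, by induction on the derivation, with its membership in H*⟦f⟧; the premise
-- e[f/x] ≤ f then absorbs the outermost unfolding.
--
-- Completeness: every t ∈ H*⟦f⟧ satisfies t ≤ f, by induction on the closure. A hypothesis step
-- e_i ≤ f_i inside a context C is replayed by the hypothesis itself, and since f_i is
-- fixpoint-free, C[f_i] ≤ f follows, by strictness and distributivity of C, from C[v] ≤ f for
-- the terms v generated by f_i. The same reduction for the fixpoint-free e turns
-- H*⟦e⟧ ⊆ H*⟦f⟧ into e ≤ f.

open import Defs

open import Data.Nat using (ℕ; zero; suc; _≤_; _<_; z≤n; s≤s)
open import Data.Nat.Properties using (≤-refl; ≤-reflexive; <⇒≤; <⇒≢; ≤⇒≯; ≤∧≢⇒<; m<n⇒m<1+n)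
open import Data.Fin using (Fin; zero; suc; toℕ; fromℕ<) renaming (_≟_ to _≟ᶠ_)
open import Data.Fin.Properties using (toℕ-fromℕ<; toℕ<n; toℕ-injective; any?)
open import Data.Vec.Functional using (_∷_)
open import Function using (id; _∘_; case_of_)
open import Function.Bundles using (_⇔_; mk⇔; Equivalence)
open import Data.Product using (Σ; ∃; _×_; _,_; proj₁; proj₂)
open import Relation.Nullary using (Dec; yes; no; contradiction)
open import Relation.Binary.Definitions using (DecidableEquality)
import Relation.Binary.Reasoning.Base.Single as Single
open import Relation.Binary.Reasoning.Syntax using (module ≤-syntax)
open import Relation.Binary.PropositionalEquality as ≡ using (_≡_; _≢_; refl)

induction-on-coordinates :
  ∀ {n} {A : Set} (S R : Fin n → A → Set) (Q : (Fin n → A) → Set) →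
  (∀ p g → S p (g p) → (∀ h → (∀ j → j ≢ p → h j ≡ g j) → R p (h p) → Q h) → Q g) →
  (∀ h → (∀ i → R i (h i)) → Q h) →
  ∀ g → (∀ i → S i (g i)) → Q g
induction-on-coordinates {n} S R Q step done g S-all =
  go n ≤-refl g (λ i _ → S-all i) (λ i n≤i → contradiction (toℕ<n i) (≤⇒≯ n≤i))
  where
  go : ∀ k → k ≤ n → ∀ g → (∀ i → toℕ i < k → S i (g i)) → (∀ i → k ≤ toℕ i → R i (g i)) → Q g
  go zero    _   g _   R-above = done g (λ i → R-above i z≤n)
  go (suc k) k<n g S-below R-above = step p g (S-below p (s≤s (≤-reflexive p≡k))) λ h h≗g Rp →
    go k (<⇒≤ k<n) h (S-below′ h h≗g) (R-above′ h h≗g Rp)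
    where
    p : Fin n
    p = fromℕ< k<n
    p≡k : toℕ p ≡ k
    p≡k = toℕ-fromℕ< k<n
    S-below′ : ∀ h → (∀ j → j ≢ p → h j ≡ g j) → ∀ i → toℕ i < k → S i (h i)
    S-below′ h h≗g i i<k = ≡.subst (S i) (≡.sym (h≗g i i≢p)) (S-below i (m<n⇒m<1+n i<k))
      where
      i≢p : i ≢ p
      i≢p refl = <⇒≢ i<k p≡k
    R-above′ : ∀ h → (∀ j → j ≢ p → h j ≡ g j) → R p (h p) → ∀ i → k ≤ toℕ i → R i (h i)
    R-above′ h h≗g Rp i k≤i with i ≟ᶠ p
    ... | yes refl = Rp
    ... | no  i≢p  = ≡.subst (R i) (≡.sym (h≗g i i≢p)) (R-above i (≤∧≢⇒< k≤i k≢i))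
      where
      k≢i : k ≢ toℕ i
      k≢i k≡i = i≢p (toℕ-injective (≡.trans (≡.sym k≡i) (≡.sym p≡k)))

module μ-Expressions (Sg : Signature) (X : Set) (_≟_ : DecidableEquality X) where
  open Syntax Sg X _≟_

  -- Syntactic equality, with the arguments of op compared pointwise (no function extensionality).
  infix 4 _≐_
  data _≐_ {n : ℕ} : Expr n → Expr n → Set where
    var : ∀ x → var x ≐ var x
    bv  : ∀ i → bv i ≐ bv i
    𝟘   : 𝟘 ≐ 𝟘
    _⊕_ : ∀ {a b c d} → a ≐ b → c ≐ d → a ⊕ c ≐ b ⊕ d
    op  : ∀ {s es fs} → (∀ i → es i ≐ fs i) → op s es ≐ op s fs
    μ   : ∀ {e f} → e ≐ f → μ e ≐ μ f

  ≐-refl : ∀ {n} {e : Expr n} → e ≐ e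
  ≐-refl {e = var x}   = var x
  ≐-refl {e = bv i}    = bv i
  ≐-refl {e = 𝟘}       = 𝟘
  ≐-refl {e = a ⊕ b}   = ≐-refl ⊕ ≐-refl
  ≐-refl {e = op s es} = op λ _ → ≐-refl
  ≐-refl {e = μ e}     = μ ≐-refl

  ≐-reflexive : ∀ {n} {e f : Expr n} → e ≡ f → e ≐ f
  ≐-reflexive refl = ≐-refl

  ≐-sym : ∀ {n} {e f : Expr n} → e ≐ f → f ≐ e
  ≐-sym (var x)  = var x
  ≐-sym (bv i)   = bv i
  ≐-sym 𝟘        = 𝟘
  ≐-sym (p ⊕ q)  = ≐-sym p ⊕ ≐-sym q
  ≐-sym (op ps)  = op λ i → ≐-sym (ps i)
  ≐-sym (μ p)    = μ (≐-sym p)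

  ≐-trans : ∀ {n} {e f g : Expr n} → e ≐ f → f ≐ g → e ≐ g
  ≐-trans (var x) (var _) = var x
  ≐-trans (bv i)  (bv _)  = bv i
  ≐-trans 𝟘       𝟘       = 𝟘
  ≐-trans (p ⊕ q) (p′ ⊕ q′) = ≐-trans p p′ ⊕ ≐-trans q q′
  ≐-trans (op ps) (op qs) = op λ i → ≐-trans (ps i) (qs i)
  ≐-trans (μ p)   (μ q)   = μ (≐-trans p q)

  ext-cong : ∀ {m k} {ρ ρ′ : Fin m → Fin k} → (∀ i → ρ i ≡ ρ′ i) → ∀ i → ext ρ i ≡ ext ρ′ i
  ext-cong ρ≗ρ′ zero    = refl
  ext-cong ρ≗ρ′ (suc i) = ≡.cong suc (ρ≗ρ′ i)

  rename-cong : ∀ {m k} {ρ ρ′ : Fin m → Fin k} {e e′ : Expr m} →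
                (∀ i → ρ i ≡ ρ′ i) → e ≐ e′ → rename ρ e ≐ rename ρ′ e′
  rename-cong ρ≗ρ′ (var x) = var x
  rename-cong ρ≗ρ′ (bv i)  = ≐-reflexive (≡.cong bv (ρ≗ρ′ i))
  rename-cong ρ≗ρ′ 𝟘       = 𝟘
  rename-cong ρ≗ρ′ (p ⊕ q) = rename-cong ρ≗ρ′ p ⊕ rename-cong ρ≗ρ′ q
  rename-cong ρ≗ρ′ (op ps) = op λ i → rename-cong ρ≗ρ′ (ps i)
  rename-cong ρ≗ρ′ (μ p)   = μ (rename-cong (ext-cong ρ≗ρ′) p)

  rename-rename : ∀ {m k l} {ρ : Fin k → Fin l} {ρ′ : Fin m → Fin k} {ρ″ : Fin m → Fin l}
                  (e : Expr m) → (∀ i → ρ (ρ′ i) ≡ ρ″ i) → rename ρ (rename ρ′ e) ≐ rename ρ″ e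
  rename-rename (var x)   h = var x
  rename-rename (bv i)    h = ≐-reflexive (≡.cong bv (h i))
  rename-rename 𝟘         h = 𝟘
  rename-rename (a ⊕ b)   h = rename-rename a h ⊕ rename-rename b h
  rename-rename (op s es) h = op λ i → rename-rename (es i) h
  rename-rename (μ e)     h = μ (rename-rename e λ { zero → refl ; (suc i) → ≡.cong suc (h i) })

  exts-cong : ∀ {m k} {σ σ′ : Fin m → Expr k} → (∀ i → σ i ≐ σ′ i) → ∀ i → exts σ i ≐ exts σ′ i
  exts-cong σ≐σ′ zero    = bv zero
  exts-cong σ≐σ′ (suc i) = rename-cong (λ _ → refl) (σ≐σ′ i)

  subst-cong : ∀ {m k} {σ σ′ : Fin m → Expr k} {e e′ : Expr m} →
               (∀ i → σ i ≐ σ′ i) → e ≐ e′ → subst σ e ≐ subst σ′ e′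
  subst-cong σ≐σ′ (var x) = var x
  subst-cong σ≐σ′ (bv i)  = σ≐σ′ i
  subst-cong σ≐σ′ 𝟘       = 𝟘
  subst-cong σ≐σ′ (p ⊕ q) = subst-cong σ≐σ′ p ⊕ subst-cong σ≐σ′ q
  subst-cong σ≐σ′ (op ps) = op λ i → subst-cong σ≐σ′ (ps i)
  subst-cong σ≐σ′ (μ p)   = μ (subst-cong (exts-cong σ≐σ′) p)

  rename-subst : ∀ {m k l} {ρ : Fin k → Fin l} {σ : Fin m → Expr k} {σ′ : Fin m → Expr l}
                 (e : Expr m) → (∀ i → rename ρ (σ i) ≐ σ′ i) → rename ρ (subst σ e) ≐ subst σ′ e
  rename-subst (var x)   h = var x
  rename-subst (bv i)    h = h i
  rename-subst 𝟘         h = 𝟘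
  rename-subst (a ⊕ b)   h = rename-subst a h ⊕ rename-subst b h
  rename-subst (op s es) h = op λ i → rename-subst (es i) h
  rename-subst {σ = σ} (μ e) h = μ (rename-subst e λ
    { zero    → bv zero
    ; (suc i) → ≐-trans (rename-rename (σ i) λ _ → refl)
                        (≐-trans (≐-sym (rename-rename (σ i) λ _ → refl)) (rename-cong (λ _ → refl) (h i))) })

  subst-rename : ∀ {m k l} {σ : Fin k → Expr l} {ρ : Fin m → Fin k} {σ′ : Fin m → Expr l}
                 (e : Expr m) → (∀ i → σ (ρ i) ≐ σ′ i) → subst σ (rename ρ e) ≐ subst σ′ e
  subst-rename (var x)   h = var x
  subst-rename (bv i)    h = h i
  subst-rename 𝟘         h = 𝟘
  subst-rename (a ⊕ b)   h = subst-rename a h ⊕ subst-rename b h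
  subst-rename (op s es) h = op λ i → subst-rename (es i) h
  subst-rename (μ e)     h = μ (subst-rename e λ
    { zero    → bv zero
    ; (suc i) → rename-cong (λ _ → refl) (h i) })

  subst-subst : ∀ {m k l} {τ : Fin k → Expr l} {σ : Fin m → Expr k} {σ′ : Fin m → Expr l}
                (e : Expr m) → (∀ i → subst τ (σ i) ≐ σ′ i) → subst τ (subst σ e) ≐ subst σ′ e
  subst-subst (var x)   h = var x
  subst-subst (bv i)    h = h i
  subst-subst 𝟘         h = 𝟘
  subst-subst (a ⊕ b)   h = subst-subst a h ⊕ subst-subst b h
  subst-subst (op s es) h = op λ i → subst-subst (es i) h
  subst-subst {σ = σ} (μ e) h = μ (subst-subst e λ
    { zero    → bv zero
    ; (suc i) → ≐-trans (subst-rename (σ i) λ _ → ≐-refl)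
                        (≐-trans (≐-sym (rename-subst (σ i) λ _ → ≐-refl)) (rename-cong (λ _ → refl) (h i))) })

  subst-id : ∀ {m} {σ : Fin m → Expr m} (e : Expr m) → (∀ i → σ i ≐ bv i) → subst σ e ≐ e
  subst-id (var x)   h = var x
  subst-id (bv i)    h = h i
  subst-id 𝟘         h = 𝟘
  subst-id (a ⊕ b)   h = subst-id a h ⊕ subst-id b h
  subst-id (op s es) h = op λ i → subst-id (es i) h
  subst-id (μ e)     h = μ (subst-id e λ
    { zero    → bv zero
    ; (suc i) → rename-cong {e′ = bv i} (λ _ → refl) (h i) })

  inst-cong : ∀ {n} {e e′ : Expr (suc n)} {a a′} → e ≐ e′ → a ≐ a′ → inst e a ≐ inst e′ a′
  inst-cong e≐e′ a≐a′ = subst-cong (λ { zero → a≐a′ ; (suc i) → bv i }) e≐e′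

  inst-subst-exts : ∀ {n} (σ : Fin n → Exp) (e : Expr (suc n)) a → inst (subst (exts σ) e) a ≐ subst (a ∷ σ) e
  inst-subst-exts σ e a = subst-subst e λ
    { zero    → ≐-refl
    ; (suc i) → ≐-trans (subst-rename {σ′ = bv} (σ i) λ ()) (subst-id (σ i) λ ()) }

  module Languages (E : Term → Term → Set) where
    open Semantics E

    infix 4 _≈_
    _≈_ : Term → Term → Set
    _≈_ = _≈E_ E

    Cl : Lang → Lang
    Cl L t = Σ Term λ u → t ≈ u × L u

    Closed : Lang → Set
    Closed L = ∀ {t u} → t ≈ u → L t → L u

    Cl-closed : ∀ {L} → Closed (Cl L)
    Cl-closed t≈u (w , t≈w , Lw) = w , trans (sym t≈u) t≈w , Lw

    Cl-map : ∀ {L K} → L ⊆ K → Cl L ⊆ Cl K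
    Cl-map L⊆K t (u , t≈u , Lu) = u , t≈u , L⊆K u Lu

    Gen-≐ : ∀ {a b t} → a ≐ b → Gen a t → Gen b t
    Gen-≐ (var x) (g-var .x) = g-var x
    Gen-≐ (p ⊕ q) (g-+ˡ G)   = g-+ˡ (Gen-≐ p G)
    Gen-≐ (p ⊕ q) (g-+ʳ G)   = g-+ʳ (Gen-≐ q G)
    Gen-≐ (op ps) (g-op Gs)  = g-op λ i → Gen-≐ (ps i) (Gs i)
    Gen-≐ (μ p)   (g-μ G)    = g-μ (Gen-≐ (inst-cong p (μ p)) G)

    -- Matching on refl names the argument function of plug (node s i ts C) t, which is local to plug.
    plug-node-≈ : ∀ {s i ts C C′ t t′} → plug C t ≈ plug C′ t′ → plug (node s i ts C) t ≈ plug (node s i ts C′) t′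
    plug-node-≈ {s} {i} {ts} {C} {C′} {t} {t′} p = cong (pointwise ≡.refl ≡.refl)
      where
      pointwise : ∀ {us vs} → plug (node s i ts C) t ≡ tnode s us → plug (node s i ts C′) t′ ≡ tnode s vs →
             ∀ j → us j ≈ vs j
      pointwise refl refl j with j ≟ᶠ i
      ... | yes _ = p
      ... | no  _ = refl

    plug-node-self : ∀ {s i ts} → plug (node s i ts □) (ts i) ≈ tnode s ts
    plug-node-self {s} {i} {ts} = cong (pointwise ≡.refl)
      where
      pointwise : ∀ {us} → plug (node s i ts □) (ts i) ≡ tnode s us → ∀ j → us j ≈ ts j
      pointwise refl j with j ≟ᶠ i
      ... | yes refl = refl
      ... | no  _    = refl

    plug-node-here : ∀ {s i ts C t us} → plug (node s i ts C) t ≡ tnode s us → us i ≡ plug C t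
    plug-node-here {i = i} refl with i ≟ᶠ i
    ... | yes _   = ≡.refl
    ... | no  i≢i = contradiction ≡.refl i≢i

    plug-node-there : ∀ {s i ts C t us} → plug (node s i ts C) t ≡ tnode s us → ∀ j → j ≢ i → us j ≡ ts j
    plug-node-there {i = i} refl j j≢i with j ≟ᶠ i
    ... | yes j≡i = contradiction j≡i j≢i
    ... | no  _   = ≡.refl

    plug-cong : ∀ C {t u} → t ≈ u → plug C t ≈ plug C u
    plug-cong □               t≈u = t≈u
    plug-cong (node s i ts C) t≈u = plug-node-≈ (plug-cong C t≈u)

    _∘ᶜ_ : Ctx → Ctx → Ctx
    □             ∘ᶜ C′ = C′
    node s i ts C ∘ᶜ C′ = node s i ts (C ∘ᶜ C′)

    plug-∘ᶜ : ∀ C C′ u → plug C (plug C′ u) ≈ plug (C ∘ᶜ C′) u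
    plug-∘ᶜ □               C′ u = refl
    plug-∘ᶜ (node s i ts C) C′ u = plug-node-≈ (plug-∘ᶜ C C′ u)

    data Plugged (C : Ctx) (M : Lang) : Lang where
      plugged : ∀ {m} → M m → Plugged C M (plug C m)

    data Node (s : Sym Sg) (M : Fin (arity Sg s) → Lang) : Lang where
      args : ∀ {us} → (∀ i → M i (us i)) → Node s M (tnode s us)

    Cl-Node : ∀ {s M us} → (∀ i → Cl (M i) (us i)) → Cl (Node s M) (tnode s us)
    Cl-Node {s} Ms = tnode s (λ i → proj₁ (Ms i)) , cong (λ i → proj₁ (proj₂ (Ms i))) , args (λ i → proj₂ (proj₂ (Ms i)))

    module Hypotheses {I : Set} (lhs rhs : I → Exp) where
      open Closure lhs rhs

      H*-mono : ∀ {L K} → L ⊆ K → H* L ⊆ H* K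
      H*-mono L⊆K t (base Lt)          = base (L⊆K t Lt)
      H*-mono L⊆K t (step h C k lu eq) = step h C (λ v r → H*-mono L⊆K _ (k v r)) lu eq

      H*-bind : ∀ {L K} → L ⊆ H* K → H* L ⊆ H* K
      H*-bind L⊆H*K t (base Lt)          = L⊆H*K t Lt
      H*-bind L⊆H*K t (step h C k lu eq) = step h C (λ v r → H*-bind L⊆H*K _ (k v r)) lu eq

      H*-closed : ∀ {L} → Closed L → Closed (H* L)
      H*-closed L-closed t≈u (base Lt)          = base (L-closed t≈u Lt)
      H*-closed L-closed t≈u (step h C k lu eq) = step h C k lu (trans (sym t≈u) eq)

      H*-plug : ∀ C {M t} → H* M t → H* (Cl (Plugged C M)) (plug C t)
      H*-plug C (base Mt) = base (_ , refl , plugged Mt)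
      H*-plug C (step h C′ k lu eq) =
        step h (C ∘ᶜ C′) (λ v r → H*-closed Cl-closed (plug-∘ᶜ C C′ v) (H*-plug C (k v r))) lu
             (trans (plug-cong C eq) (plug-∘ᶜ C C′ _))

      H*-Node : ∀ s (M : Fin (arity Sg s) → Lang) us → (∀ i → H* (Cl (M i)) (us i)) → H* (Cl (Node s M)) (tnode s us)
      H*-Node s M = induction-on-coordinates (λ i → H* (Cl (M i))) (λ i → Cl (M i))
                      (λ us → H* (Cl (Node s M)) (tnode s us)) one-argument (λ us Ms → base (Cl-Node Ms))
        where
        one-argument : ∀ p us → H* (Cl (M p)) (us p) →
               (∀ vs → (∀ j → j ≢ p → vs j ≡ us j) → Cl (M p) (vs p) → H* (Cl (Node s M)) (tnode s vs)) →
               H* (Cl (Node s M)) (tnode s us)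
        one-argument p us H*Mp k = H*-closed Cl-closed plug-node-self (H*-bind continue _ (H*-plug (node s p us □) H*Mp))
          where
          continue : Cl (Plugged (node s p us □) (Cl (M p))) ⊆ H* (Cl (Node s M))
          continue w (_ , w≈ , plugged {m} Mm) =
            H*-closed Cl-closed (sym w≈)
              (k _ (plug-node-there ≡.refl) (≡.subst (Cl (M p)) (≡.sym (plug-node-here {s} {p} {us} {□} {m} ≡.refl)) Mm))

  module OpenGeneration (E : Term → Term → Set) where
    open Semantics E
    open Languages E

    -- Gen⟨ K ⟩ Γ e generates from an open expression e whose bound variables are described by Γ:
    -- a hole generates K, a μ-binder re-enters its fixpoint. close g Γ is the matching closing
    -- substitution, with g at the holes.
    data Binder (n : ℕ) : Set where
      hole : Binder n
      body : Expr (suc n) → Binder n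

    data Binders : ℕ → Set where
      []  : Binders zero
      _▸_ : ∀ {n} → Binders n → Binder n → Binders (suc n)

    data Gen⟨_⟩ (K : Lang) : ∀ {n} → Binders n → Expr n → Lang where
      g-var  : ∀ {n} {Γ : Binders n} x → Gen⟨ K ⟩ Γ (var x) (tvar x)
      g-+ˡ   : ∀ {n} {Γ : Binders n} {a b t} → Gen⟨ K ⟩ Γ a t → Gen⟨ K ⟩ Γ (a ⊕ b) t
      g-+ʳ   : ∀ {n} {Γ : Binders n} {a b t} → Gen⟨ K ⟩ Γ b t → Gen⟨ K ⟩ Γ (a ⊕ b) t
      g-op   : ∀ {n} {Γ : Binders n} {o es ts} → (∀ i → Gen⟨ K ⟩ Γ (es i) (ts i)) → Gen⟨ K ⟩ Γ (op o es) (tnode o ts)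
      g-μ    : ∀ {n} {Γ : Binders n} {e t} → Gen⟨ K ⟩ (Γ ▸ body e) e t → Gen⟨ K ⟩ Γ (μ e) t
      g-hole : ∀ {n} {Γ : Binders n} {t} → K t → Gen⟨ K ⟩ (Γ ▸ hole) (bv zero) t
      g-rec  : ∀ {n} {Γ : Binders n} {e t} → Gen⟨ K ⟩ Γ (μ e) t → Gen⟨ K ⟩ (Γ ▸ body e) (bv zero) t
      g-wk   : ∀ {n} {Γ : Binders n} {b i t} → Gen⟨ K ⟩ Γ (bv i) t → Gen⟨ K ⟩ (Γ ▸ b) (bv (suc i)) t

    close : ∀ {n} → Exp → Binders n → Fin n → Exp
    -- The suc clause comes first so that close g (Γ ▸ b) (suc i) reduces for an unknown binder b.
    close g (Γ ▸ _)      (suc i) = close g Γ i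
    close g (Γ ▸ hole)   zero    = g
    close g (Γ ▸ body e) zero    = μ (subst (exts (close g Γ)) e)

    unfold-close : ∀ {n} g (Γ : Binders n) e {x} → x ≐ subst (exts (close g Γ)) e →
                   inst x (μ x) ≐ subst (close g (Γ ▸ body e)) e
    unfold-close g Γ e x≐ = ≐-trans (inst-cong x≐ (μ x≐))
      (≐-trans (inst-subst-exts (close g Γ) e _) (subst-cong {e = e} (λ { zero → ≐-refl ; (suc i) → ≐-refl }) ≐-refl))

    Gen⇒Gen⟨⟩ : ∀ {n g} (Γ : Binders n) e {x t} → x ≐ subst (close g Γ) e → Gen x t → Gen⟨ Gen g ⟩ Γ e t
    Gen⇒Gen⟨⟩ Γ (var y)   (var .y) (g-var .y) = g-var y
    Gen⇒Gen⟨⟩ Γ (a ⊕ b)   (p ⊕ q)  (g-+ˡ G)   = g-+ˡ (Gen⇒Gen⟨⟩ Γ a p G)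
    Gen⇒Gen⟨⟩ Γ (a ⊕ b)   (p ⊕ q)  (g-+ʳ G)   = g-+ʳ (Gen⇒Gen⟨⟩ Γ b q G)
    Gen⇒Gen⟨⟩ Γ (op o es) (op ps)  (g-op Gs)  = g-op λ i → Gen⇒Gen⟨⟩ Γ (es i) (ps i) (Gs i)
    Gen⇒Gen⟨⟩ {g = g} Γ (μ e) (μ p) (g-μ G)   = g-μ (Gen⇒Gen⟨⟩ (Γ ▸ body e) e (unfold-close g Γ e p) G)
    Gen⇒Gen⟨⟩ (Γ ▸ hole) (bv zero) p G        = g-hole (Gen-≐ p G)
    Gen⇒Gen⟨⟩ {g = g} (Γ ▸ body e) (bv zero) (μ p) (g-μ G) =
      g-rec (g-μ (Gen⇒Gen⟨⟩ (Γ ▸ body e) e (unfold-close g Γ e p) G))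
    Gen⇒Gen⟨⟩ (Γ ▸ _)    (bv (suc i)) p G     = g-wk (Gen⇒Gen⟨⟩ Γ (bv i) p G)

    Gen⟨⟩⇒Gen : ∀ {n g} {Γ : Binders n} {e t} → Gen⟨ Gen g ⟩ Γ e t → Gen (subst (close g Γ) e) t
    Gen⟨⟩⇒Gen (g-var x)  = g-var x
    Gen⟨⟩⇒Gen (g-+ˡ G)   = g-+ˡ (Gen⟨⟩⇒Gen G)
    Gen⟨⟩⇒Gen (g-+ʳ G)   = g-+ʳ (Gen⟨⟩⇒Gen G)
    Gen⟨⟩⇒Gen (g-op Gs)  = g-op λ i → Gen⟨⟩⇒Gen (Gs i)
    Gen⟨⟩⇒Gen {g = g} {Γ = Γ} (g-μ {e = e} G) = g-μ (Gen-≐ (≐-sym (unfold-close g Γ e ≐-refl)) (Gen⟨⟩⇒Gen G))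
    Gen⟨⟩⇒Gen (g-hole G) = G
    Gen⟨⟩⇒Gen (g-rec G)  = Gen⟨⟩⇒Gen G
    Gen⟨⟩⇒Gen (g-wk G)   = Gen⟨⟩⇒Gen G

    module _ {I : Set} (lhs rhs : I → Exp) where
      open Closure lhs rhs
      open Hypotheses lhs rhs

      Gen⟨⟩-H* : ∀ {L n} {Γ : Binders n} {e t} → Gen⟨ H* (Cl L) ⟩ Γ e t → H* (Cl (Gen⟨ L ⟩ Γ e)) t
      Gen⟨⟩-H* (g-var x)  = base (tvar x , refl , g-var x)
      Gen⟨⟩-H* (g-+ˡ G)   = H*-mono (Cl-map λ _ → g-+ˡ) _ (Gen⟨⟩-H* G)
      Gen⟨⟩-H* (g-+ʳ G)   = H*-mono (Cl-map λ _ → g-+ʳ) _ (Gen⟨⟩-H* G)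
      Gen⟨⟩-H* (g-op Gs)  = H*-mono (Cl-map λ { _ (args Gs′) → g-op Gs′ }) _ (H*-Node _ _ _ λ i → Gen⟨⟩-H* (Gs i))
      Gen⟨⟩-H* (g-μ G)    = H*-mono (Cl-map λ _ → g-μ) _ (Gen⟨⟩-H* G)
      Gen⟨⟩-H* (g-hole G) = H*-mono (Cl-map λ _ → g-hole) _ G
      Gen⟨⟩-H* (g-rec G)  = H*-mono (Cl-map λ _ → g-rec) _ (Gen⟨⟩-H* G)
      Gen⟨⟩-H* (g-wk G)   = H*-mono (Cl-map λ _ → g-wk) _ (Gen⟨⟩-H* G)

      module _ (e : Expr 1) (g : Exp) (premise : H* ⟦ inst e g ⟧ ⊆ H* ⟦ g ⟧) where

        data Replaces : ∀ {n} → Binders n → Binders n → Set where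
          bottom : Replaces ([] ▸ body e) ([] ▸ hole)
          under  : ∀ {n} {Γ Γ′ : Binders n} {b} → Replaces Γ Γ′ → Replaces (Γ ▸ body b) (Γ′ ▸ body b)

        fold-premise : ∀ {t} → Gen⟨ H* ⟦ g ⟧ ⟩ ([] ▸ hole) e t → H* ⟦ g ⟧ t
        fold-premise G = premise _ (H*-mono (Cl-map λ _ G′ → Gen-≐ (≐-sym inst≐close) (Gen⟨⟩⇒Gen G′)) _ (Gen⟨⟩-H* G))
          where
          inst≐close : inst e g ≐ subst (close g ([] ▸ hole)) e
          inst≐close = subst-cong {e = e} (λ { zero → ≐-refl ; (suc ()) }) ≐-refl

        -- Every recursive occurrence of μ e is replaced by a hole, justified by μ-least on the
        -- smaller derivation.
        mutual
          μ-least : ∀ {K t} → Gen⟨ K ⟩ [] (μ e) t → H* ⟦ g ⟧ t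
          μ-least (g-μ G) = fold-premise (replace bottom G)

          replace : ∀ {K n} {Γ Γ′ : Binders n} {b t} → Replaces Γ Γ′ → Gen⟨ K ⟩ Γ b t → Gen⟨ H* ⟦ g ⟧ ⟩ Γ′ b t
          replace r (g-var x)  = g-var x
          replace r (g-+ˡ G)   = g-+ˡ (replace r G)
          replace r (g-+ʳ G)   = g-+ʳ (replace r G)
          replace r (g-op Gs)  = g-op λ i → replace r (Gs i)
          replace r (g-μ G)    = g-μ (replace (under r) G)
          replace bottom    (g-rec G) = g-hole (μ-least G)
          replace (under r) (g-rec G) = g-rec (replace r G)
          replace (under r) (g-wk G)  = g-wk (replace r G)
          replace bottom    (g-wk {i = ()} _)

        μ-induction : H* ⟦ μ e ⟧ ⊆ H* ⟦ g ⟧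
        μ-induction = H*-bind λ { t (u , t≈u , G) →
          H*-closed Cl-closed (sym t≈u) (μ-least (Gen⇒Gen⟨⟩ {g = 𝟘} [] (μ e) (μ μe-closed) G)) }
          where
          μe-closed : e ≐ subst (exts (close 𝟘 [])) e
          μe-closed = ≐-sym (subst-id e λ { zero → bv zero ; (suc ()) })

  module Matching (E : Term → Term → Set) where
    open Semantics E
    open Languages E

    occurs? : ∀ x t → Dec (Occurs x t)
    occurs? x (tvar y) with x ≟ y
    ... | yes refl = yes here
    ... | no  x≢y  = no λ { here → x≢y ≡.refl }
    occurs? x (tnode s ts) with any? (λ i → occurs? x (ts i))
    ... | yes (i , o) = yes (inside i o)
    ... | no  ¬o      = no λ { (inside i o) → ¬o (i , o) }

    tsub-agree : ∀ {τ₁ τ₂} l → (∀ x → Occurs x l → τ₁ x ≡ τ₂ x) → tsub τ₁ l ≈ tsub τ₂ l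
    tsub-agree (tvar x)     τ₁≗τ₂ = ≡.subst (_ ≈_) (τ₁≗τ₂ x here) refl
    tsub-agree (tnode s ts) τ₁≗τ₂ = cong λ i → tsub-agree (ts i) λ x o → τ₁≗τ₂ x (inside i o)

    Matches : (X → Exp) → Term → Term → Set
    Matches σ l t = Σ (X → Term) λ τ → (∀ x → Occurs x l → Gen (σ x) (τ x)) × t ≈ tsub τ l

    match : ∀ σ l {t} → LinearTerm l → Gen (texp σ l) t → Matches σ l t
    match σ (tvar y) {t} _ G = (λ _ → t) , (λ { _ here → G }) , refl
    match σ (tnode s ls) (lnode lin disjoint) (g-op {ts = ts} Gs) =
      τ , Gen-τ , cong λ i → trans (proj₂ (proj₂ (M i))) (tsub-agree (ls i) (agree i))
      where
      M : ∀ i → Matches σ (ls i) (ts i)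
      M i = match σ (ls i) (lin i) (Gs i)
      pick : ∀ z → Dec (∃ λ i → Occurs z (ls i)) → Term
      pick z (yes (i , _)) = proj₁ (M i) z
      pick z (no _)        = tvar z
      τ : X → Term
      τ z = pick z (any? λ i → occurs? z (ls i))
      Gen-τ : ∀ x → Occurs x (tnode s ls) → Gen (σ x) (τ x)
      Gen-τ x (inside i o) with any? (λ i → occurs? x (ls i))
      ... | yes (j , o′) = proj₁ (proj₂ (M j)) x o′
      ... | no  ¬o       = contradiction (i , o) ¬o
      -- By linearity x occurs in no other argument, so τ x was picked from the matcher of ls i.
      agree : ∀ i x → Occurs x (ls i) → proj₁ (M i) x ≡ τ x
      agree i x o with any? (λ i → occurs? x (ls i))
      ... | yes (j , o′) with disjoint x i j o o′
      ...   | refl = ≡.refl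
      agree i x o | no ¬o = contradiction (i , o) ¬o

    Gen-texp-tsub : ∀ σ τ r → (∀ x → Occurs x r → Gen (σ x) (τ x)) → Gen (texp σ r) (tsub τ r)
    Gen-texp-tsub σ τ (tvar x)     Gen-στ = Gen-στ x here
    Gen-texp-tsub σ τ (tnode s rs) Gen-στ = g-op λ i → Gen-texp-tsub σ τ (rs i) λ x o → Gen-στ x (inside i o)

    instance-sound : ∀ {l r} → LinearTerm l → (∀ x → Occurs x r → Occurs x l) → (∀ τ → tsub τ l ≈ tsub τ r) →
                     ∀ σ → Gen (texp σ l) ⊆ ⟦ texp σ r ⟧
    instance-sound {l} {r} lin vars-r⊆l l≈r σ t G with match σ l lin G
    ... | τ , Gen-στ , t≈ = tsub τ r , trans t≈ (l≈r τ) , Gen-texp-tsub σ τ r λ x o → Gen-στ x (vars-r⊆l x o)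

  module Derivability (E : Term → Term → Set) (F : Exp → Set) {I : Set} (lhs rhs : I → Exp) where
    open Semantics E
    open Closure lhs rhs
    open Naive E F lhs rhs
    open Languages E
    open Hypotheses lhs rhs
    open OpenGeneration E using (μ-induction)
    open Matching E using (instance-sound)


    infix 4 ⊢_≤_
    ⊢_≤_ : Exp → Exp → Set
    ⊢ a ≤ b = _⊢_≤_ a b

    module ≤-Reasoning where
      open Single ⊢_≤_ refl trans public using (begin_; _∎)
      open Single ⊢_≤_ refl trans using (_IsRelatedTo_; ∼-go)
      open ≤-syntax _IsRelatedTo_ _IsRelatedTo_ ∼-go public

    ⊢-reflexive : ∀ {a b} → a ≡ b → ⊢ a ≤ b
    ⊢-reflexive refl = refl

    upd-here : ∀ {s} (g : Fin (arity Sg s) → Exp) p a → upd g p a p ≡ a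
    upd-here g p a with p ≟ᶠ p
    ... | yes _   = ≡.refl
    ... | no  p≢p = contradiction ≡.refl p≢p

    upd-there : ∀ {s} (g : Fin (arity Sg s) → Exp) p a j → j ≢ p → upd g p a j ≡ g j
    upd-there g p a j j≢p with j ≟ᶠ p
    ... | yes j≡p = contradiction j≡p j≢p
    ... | no  _   = ≡.refl

    H*-base : ∀ {a t} → Gen a t → H* ⟦ a ⟧ t
    H*-base G = base (_ , refl , G)

    module Soundness (linear : ∀ {l r} → E l r → LinearEq l r) (regular : ∀ {l r} → E l r → RegularEq l r) where

      module _ {s} {es : Fin (arity Sg s) → Exp} {i : Fin (arity Sg s)} {ts : Fin (arity Sg s) → Term} where

        Gen-upd-here : ∀ {a} → (∀ j → Gen (upd es i a j) (ts j)) → Gen a (ts i)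
        Gen-upd-here {a} Gs = ≡.subst (λ x → Gen x (ts i)) (upd-here es i a) (Gs i)

        Gen-upd : ∀ {a b} → (∀ j → Gen (upd es i a j) (ts j)) → Gen b (ts i) → ∀ j → Gen (upd es i b j) (ts j)
        Gen-upd Gs G j with j ≟ᶠ i | Gs j
        ... | yes refl | _  = G
        ... | no  _    | Gj = Gj

      Gen-lift : ∀ {a b} → (∀ {t} → Gen a t → Gen b t) → H* ⟦ a ⟧ ⊆ H* ⟦ b ⟧
      Gen-lift a⊆b = H*-mono (Cl-map λ _ → a⊆b)

      H*-lift : ∀ {a b} → Gen a ⊆ H* ⟦ b ⟧ → H* ⟦ a ⟧ ⊆ H* ⟦ b ⟧
      H*-lift a⊆b = H*-bind λ { t (u , t≈u , G) → H*-closed Cl-closed (sym t≈u) (a⊆b u G) }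

      sound : ∀ {a b} → ⊢ a ≤ b → H* ⟦ a ⟧ ⊆ H* ⟦ b ⟧
      sound 0≤                      = Gen-lift λ ()
      sound idem                    = Gen-lift λ { (g-+ˡ G) → G ; (g-+ʳ G) → G }
      sound inl                     = Gen-lift g-+ˡ
      sound inr                     = Gen-lift g-+ʳ
      sound (strict i)              = Gen-lift λ { (g-op Gs) → case Gen-upd-here Gs of λ () }
      sound (strict⁻ i)             = Gen-lift λ ()
      sound (distr i a b)           = Gen-lift λ { (g-op Gs) → case Gen-upd-here Gs of λ
        { (g-+ˡ G) → g-+ˡ (g-op (Gen-upd Gs G))
        ; (g-+ʳ G) → g-+ʳ (g-op (Gen-upd Gs G)) } }
      sound (distr⁻ i a b)          = Gen-lift λ
        { (g-+ˡ (g-op Gs)) → g-op (Gen-upd Gs (g-+ˡ (Gen-upd-here Gs)))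
        ; (g-+ʳ (g-op Gs)) → g-op (Gen-upd Gs (g-+ʳ (Gen-upd-here Gs))) }
      sound (eqn e σ)               = H*-lift λ t G →
        base (instance-sound (proj₁ (linear e)) (λ x → Equivalence.from (regular e x)) (ax e) σ t G)
      sound (eqn⁻ e σ)              = H*-lift λ t G →
        base (instance-sound (proj₂ (linear e)) (λ x → Equivalence.to (regular e x)) (λ τ → sym (ax e τ)) σ t G)
      sound (unfold _)              = Gen-lift g-μ
      sound (induct {e} {g} _ _ d)  = μ-induction lhs rhs e g (sound d)
      sound (hyp h)                 = H*-lift λ t G → step h □ (λ _ → base) (t , refl , G) refl
      sound refl                    = λ _ → id
      sound (trans d d′)            = λ t → sound d′ t ∘ sound d t
      sound (mono-+ d d′)           = H*-lift λ
        { t (g-+ˡ G) → Gen-lift g-+ˡ t (sound d t (H*-base G))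
        ; t (g-+ʳ G) → Gen-lift g-+ʳ t (sound d′ t (H*-base G)) }
      sound (mono-op {s} {fs = fs} ds) = H*-lift λ { _ (g-op Gs) →
        H*-mono (Cl-map λ { _ (args Gs′) → g-op Gs′ }) _ (H*-Node s (Gen ∘ fs) _ λ i → sound (ds i) _ (H*-base (Gs i))) }

    ⌜_⌝ : Term → Exp
    ⌜ t ⌝ = texp var t

    infix 4 _≅_
    _≅_ : Exp → Exp → Set
    a ≅ b = ⊢ a ≤ b × ⊢ b ≤ a

    ≅-refl : ∀ {a} → a ≅ a
    ≅-refl = refl , refl

    ≅-sym : ∀ {a b} → a ≅ b → b ≅ a
    ≅-sym (a≤b , b≤a) = b≤a , a≤b

    ≅-trans : ∀ {a b c} → a ≅ b → b ≅ c → a ≅ c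
    ≅-trans (a≤b , b≤a) (b≤c , c≤b) = trans a≤b b≤c , trans c≤b b≤a

    ≅-op : ∀ {s es fs} → (∀ i → es i ≅ fs i) → op s es ≅ op s fs
    ≅-op es≅fs = mono-op (proj₁ ∘ es≅fs) , mono-op (proj₂ ∘ es≅fs)

    ⌜tsub⌝≅texp : ∀ τ l → ⌜ tsub τ l ⌝ ≅ texp (⌜_⌝ ∘ τ) l
    ⌜tsub⌝≅texp τ (tvar x)     = ≅-refl
    ⌜tsub⌝≅texp τ (tnode s ts) = ≅-op λ i → ⌜tsub⌝≅texp τ (ts i)

    ≈⇒≅ : ∀ {t u} → t ≈ u → ⌜ t ⌝ ≅ ⌜ u ⌝
    ≈⇒≅ (ax {l} {r} e τ) = ≅-trans (⌜tsub⌝≅texp τ l) (≅-trans (eqn e _ , eqn⁻ e _) (≅-sym (⌜tsub⌝≅texp τ r)))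
    ≈⇒≅ refl             = ≅-refl
    ≈⇒≅ (sym t≈u)        = ≅-sym (≈⇒≅ t≈u)
    ≈⇒≅ (trans t≈u u≈v)  = ≅-trans (≈⇒≅ t≈u) (≈⇒≅ u≈v)
    ≈⇒≅ (cong ts≈us)     = ≅-op λ i → ≈⇒≅ (ts≈us i)

    ⌜_⌝[_] : Ctx → Exp → Exp
    ⌜ □ ⌝[ a ]             = a
    ⌜ node s i ts C ⌝[ a ] = op s (upd (⌜_⌝ ∘ ts) i ⌜ C ⌝[ a ])

    plug-≅ : ∀ C t → ⌜ plug C t ⌝ ≅ ⌜ C ⌝[ ⌜ t ⌝ ]
    plug-≅ □               t = ≅-refl
    plug-≅ (node s i ts C) t = ≅-op (pointwise ≡.refl)
      where
      pointwise : ∀ {us} → plug (node s i ts C) t ≡ tnode s us → ∀ j → ⌜ us j ⌝ ≅ upd (⌜_⌝ ∘ ts) i ⌜ C ⌝[ ⌜ t ⌝ ] j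
      pointwise refl j with j ≟ᶠ i
      ... | yes _ = plug-≅ C t
      ... | no  _ = ≅-refl

    record Linear (D : Exp → Exp) : Set where
      field
        monotone  : ∀ {a b} → ⊢ a ≤ b → ⊢ D a ≤ D b
        distrib-⊕ : ∀ {a b} → ⊢ D (a ⊕ b) ≤ D a ⊕ D b
        strict-𝟘  : ⊢ D 𝟘 ≤ 𝟘
    open Linear

    id-linear : Linear id
    id-linear = record { monotone = id ; distrib-⊕ = refl ; strict-𝟘 = refl }

    ∘-linear : ∀ {D D′} → Linear D → Linear D′ → Linear (D ∘ D′)
    ∘-linear D-lin D′-lin = record
      { monotone  = monotone D-lin ∘ monotone D′-lin
      ; distrib-⊕ = trans (monotone D-lin (distrib-⊕ D′-lin)) (distrib-⊕ D-lin)
      ; strict-𝟘  = trans (monotone D-lin (strict-𝟘 D′-lin)) (strict-𝟘 D-lin)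
      }

    upd-mono : ∀ {s} (g : Fin (arity Sg s) → Exp) p {a b} → ⊢ a ≤ b → ∀ j → ⊢ upd g p a j ≤ upd g p b j
    upd-mono g p a≤b j with j ≟ᶠ p
    ... | yes _ = a≤b
    ... | no  _ = refl

    op-linear : ∀ {s} (g : Fin (arity Sg s) → Exp) p → Linear (λ a → op s (upd g p a))
    op-linear g p = record { monotone = mono-op ∘ upd-mono g p ; distrib-⊕ = distr p _ _ ; strict-𝟘 = strict p }

    ctx-linear : ∀ C → Linear ⌜ C ⌝[_]
    ctx-linear □               = id-linear
    ctx-linear (node s i ts C) = ∘-linear (op-linear (⌜_⌝ ∘ ts) i) (ctx-linear C)

    bound-by-generated : ∀ {a f D} → FixFree a → Linear D → (∀ v → Gen a v → ⊢ D ⌜ v ⌝ ≤ f) → ⊢ D a ≤ f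
    bound-by-generated (ff-var x) D-lin bound = bound (tvar x) (g-var x)
    bound-by-generated ff-0       D-lin bound = trans (strict-𝟘 D-lin) 0≤
    bound-by-generated (ff-+ p q) D-lin bound = trans (distrib-⊕ D-lin)
      (trans (mono-+ (bound-by-generated p D-lin λ v → bound v ∘ g-+ˡ)
                     (bound-by-generated q D-lin λ v → bound v ∘ g-+ʳ)) idem)
    bound-by-generated {f = f} {D} (ff-op {s} {es} ps) D-lin bound =
      induction-on-coordinates (λ p a → a ≡ es p) (λ p a → Σ Term λ v → a ≡ ⌜ v ⌝ × Gen (es p) v)
        (λ g → ⊢ D (op s g) ≤ f) one-argument all-generated es (λ _ → ≡.refl)
      where
      all-generated : ∀ g → (∀ i → Σ Term λ v → g i ≡ ⌜ v ⌝ × Gen (es i) v) → ⊢ D (op s g) ≤ f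
      all-generated g vs = trans (monotone D-lin (mono-op (⊢-reflexive ∘ proj₁ ∘ proj₂ ∘ vs)))
                                 (bound (tnode s (proj₁ ∘ vs)) (g-op (proj₂ ∘ proj₂ ∘ vs)))
      one-argument : ∀ p g → g p ≡ es p →
                     (∀ h → (∀ j → j ≢ p → h j ≡ g j) → Σ Term (λ v → h p ≡ ⌜ v ⌝ × Gen (es p) v) → ⊢ D (op s h) ≤ f) →
                     ⊢ D (op s g) ≤ f
      one-argument p g gp≡esp k = trans (monotone D-lin (mono-op g≤upd))
        (bound-by-generated (ps p) (∘-linear D-lin (op-linear g p)) λ v G →
          k (upd g p ⌜ v ⌝) (upd-there g p ⌜ v ⌝) (v , upd-here g p ⌜ v ⌝ , G))
        where
        g≤upd : ∀ j → ⊢ g j ≤ upd g p (es p) j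
        g≤upd j with j ≟ᶠ p
        ... | yes refl = ⊢-reflexive gp≡esp
        ... | no  _    = refl

    module Completeness (isF : IsFragment F) (F-lhs : ∀ i → F (lhs i)) (fixfree-rhs : ∀ i → FixFree (rhs i)) where
      open IsFragment isF
      open ≤-Reasoning

      Gen⇒≤ : ∀ {a u} → F a → Gen a u → ⊢ ⌜ u ⌝ ≤ a
      Gen⇒≤ Fa (g-var x) = refl
      Gen⇒≤ Fa (g-+ˡ G)  = trans (Gen⇒≤ (sub-+ˡ Fa) G) inl
      Gen⇒≤ Fa (g-+ʳ G)  = trans (Gen⇒≤ (sub-+ʳ Fa) G) inr
      Gen⇒≤ Fa (g-op Gs) = mono-op λ i → Gen⇒≤ (sub-op Fa i) (Gs i)
      Gen⇒≤ Fa (g-μ G)   = trans (Gen⇒≤ (clo-unfold Fa Fa) G) (unfold Fa)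

      H*⇒≤ : ∀ {f t} → F f → H* ⟦ f ⟧ t → ⊢ ⌜ t ⌝ ≤ f
      H*⇒≤ Ff (base (u , t≈u , G)) = trans (proj₁ (≈⇒≅ t≈u)) (Gen⇒≤ Ff G)
      H*⇒≤ {f} {t} Ff (step {u = u} h C k (w , u≈w , G) t≈Cu) = begin
        ⌜ t ⌝          ≤⟨ proj₁ (≈⇒≅ t≈Cu) ⟩
        ⌜ plug C u ⌝   ≤⟨ proj₁ (plug-≅ C u) ⟩
        ⌜ C ⌝[ ⌜ u ⌝ ] ≤⟨ monotone (ctx-linear C) (trans (proj₁ (≈⇒≅ u≈w)) (Gen⇒≤ (F-lhs h) G)) ⟩
        ⌜ C ⌝[ lhs h ] ≤⟨ monotone (ctx-linear C) (hyp h) ⟩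
        ⌜ C ⌝[ rhs h ] ≤⟨ bound-by-generated (fixfree-rhs h) (ctx-linear C) (λ v G′ →
                            trans (proj₂ (plug-≅ C v)) (H*⇒≤ Ff (k v (v , refl , G′)))) ⟩
        f              ∎

      complete : ∀ {e f} → FixFree e → F f → H* ⟦ e ⟧ ⊆ H* ⟦ f ⟧ → ⊢ e ≤ f
      complete fixfree-e Ff e⊆f = bound-by-generated fixfree-e id-linear λ v G → H*⇒≤ Ff (e⊆f v (H*-base G))

theorem5p10 : (Sg : Signature) (X : Set) (_≟_ : DecidableEquality X) →
    let open Syntax Sg X _≟_ in
    (E : Term → Term → Set) →
    (∀ {l r} → E l r → LinearEq l r) →
    (∀ {l r} → E l r → RegularEq l r) →
    (F : Exp → Set) → IsFragment F →
    (I : Set) (lhs rhs : I → Exp) →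
    (∀ i → F (lhs i)) → (∀ i → F (rhs i)) →
    (e f : Exp) → F e → F f →
    FixFree e → (∀ i → FixFree (rhs i)) →
    let open Semantics E in
    let open Closure lhs rhs in
    let open Naive E F lhs rhs in
    ((_⊢_≤_ e f) ⇔ (H* ⟦ e ⟧ ⊆ H* ⟦ f ⟧))
theorem5p10 Sg X _≟_ E linear regular F isF I lhs rhs F-lhs _ e f _ Ff fixfree-e fixfree-rhs =
  mk⇔ sound (complete fixfree-e Ff)
  where
  open μ-Expressions Sg X _≟_
  open Derivability E F lhs rhs
  open Soundness linear regular
  open Completeness isF F-lhs fixfree-rhs
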